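{- Let $G$ be a graph without isolated vertices and let $S$ be a total dominating set of $G$. Let $H$ be the subgraph of $G$ consisting of the components of $G[S]$ of order at least $3$, and let $X$ be the set of stems of $H$. Then $S$ is a minimal total dominating set of $G$ if and only if $\operatorname{EPN}(s,S)\neq\varnothing$ for each $s\in V(H)-X$.
   Context: A total dominating set (TDS) of a graph $G$ without isolated vertices is a set $S\subseteq V(G)$ such that every vertex of $G$ is adjacent to a vertex of $S$. A minimal TDS (MTDS) is a TDS no proper subset of which is a TDS. $G[S]$ is the subgraph induced by $S$. A leaf is a vertex of degree $1$; a stem of a graph $F\not\cong K_2$ is the unique neighbour of a leaf (stems of $H$ are taken with respect to $H$, i.e. vertices of $H$ adjacent in $H$ to a vertex of degree $1$ in $H$). For $s\in S$, the open private neighbourhood is $\operatorname{OPN}(s,S)=N(s)-\bigcup_{s'\in S-\{s\}}N(s')$, where $N(v)$ is the open neighbourhood of $v$; the external private neighbourhood is $\operatorname{EPN}(s,S)=\operatorname{OPN}(s,S)\cap (V(G)-S)$. -}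

module Defs where

open import Data.Nat using (ℕ)
open import Data.Fin using (Fin)
open import Data.Fin.Subset using (Subset; _∈_; _∉_; _⊂_)
open import Data.Product using (Σ; ∃; _×_)
open import Relation.Nullary using (¬_; Dec)
open import Relation.Binary.PropositionalEquality using (_≡_; _≢_)
open import Function.Bundles using (_⇔_)

record Graph (n : ℕ) : Set₁ where
  field
    Adj     : Fin n → Fin n → Set
    sym     : ∀ {u v} → Adj u v → Adj v u
    irrefl  : ∀ {u} → ¬ Adj u u
    Adj?    : ∀ u v → Dec (Adj u v)
open Graph public

module _ {n : ℕ} (G : Graph n) where

  NoIsolated : Set
  NoIsolated = ∀ v → ∃ λ u → Adj G v u

  IsTDS : Subset n → Set
  IsTDS S = ∀ v → ∃ λ u → u ∈ S × Adj G v u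

  IsMTDS : Subset n → Set
  IsMTDS S = IsTDS S × (∀ T → T ⊂ S → ¬ IsTDS T)

  data Conn (S : Subset n) : Fin n → Fin n → Set where
    here : ∀ {u} → u ∈ S → Conn S u u
    step : ∀ {u w v} → u ∈ S → Adj G u w → Conn S w v → Conn S u v

  -- v lies in a component of G[S] of order at least 3, i.e. v ∈ V(H)
  InH : Subset n → Fin n → Set
  InH S v = ∃ λ a → ∃ λ b → ∃ λ c →
    a ≢ b × a ≢ c × b ≢ c × Conn S v a × Conn S v b × Conn S v c

  -- y is a leaf of H: y ∈ V(H) and y has exactly one neighbour in H
  -- (H is a union of components of G[S], hence an induced subgraph of G)
  LeafH : Subset n → Fin n → Set
  LeafH S y = InH S y × ∃ λ z → InH S z × Adj G y z ×
    (∀ z' → InH S z' → Adj G y z' → z' ≡ z)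

  StemH : Subset n → Fin n → Set
  StemH S x = InH S x × ∃ λ y → LeafH S y × Adj G x y

  EPNNonempty : Subset n → Fin n → Set
  EPNNonempty S s = ∃ λ v → v ∉ S × Adj G s v ×
    (∀ s' → s' ∈ S → s' ≢ s → ¬ Adj G s' v)

module Submission where

-- Call OPN(s,S) ≠ ∅ the property that some vertex v adjacent
-- to s has s as its ONLY neighbour in S.  The classical characterisation
-- (minimal⇔OPN) says a TDS S is minimal iff OPN(s,S) ≠ ∅ for every s ∈ S:
-- removing s leaves some v undominated exactly when such a v exists.
-- The corollary refines this by sorting the vertices of S:
--   * s outside H (its component of G[S] has order 2): its S-neighbour w
--     has s as only S-neighbour, since a second one would give 3 vertices;
--   * s a stem of H: a leaf y adjacent to s has s as only S-neighbour;
--   * s ∈ V(H) not a stem: here OPN and EPN coincide, because a private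
--     neighbour v ∈ S would make v a leaf of H and s its stem.
-- So only the third kind of vertex imposes a condition, which is EPN ≠ ∅.
-- Since the final argument is by cases on undecided properties (InH, StemH),
-- we prove OPN(s,S) ≠ ∅ under a double negation and remove it using the
-- decidability of OPN over the finite vertex set.

open import Defs
open import Data.Nat using (ℕ)
open import Data.Fin using (Fin; _≟_)
open import Data.Fin.Subset using (Subset; _∈_; _∉_; _-_)
open import Data.Fin.Subset.Properties using (_∈?_; x∈p∧x≢y⇒x∈p-y; x∈p⇒p-x⊂p)
open import Data.Fin.Properties using (any?; all?; ¬∀⟶∃¬)
open import Data.Product using (∃; _×_; _,_)
open import Relation.Nullary using (¬_; Dec; yes; no)
open import Relation.Nullary.Decidable using (_×-dec_; _→-dec_; decidable-stable; ¬¬-excluded-middle)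
open import Relation.Binary.PropositionalEquality using (_≡_; subst; trans) renaming (sym to ≡-sym)
open import Function.Bundles using (_⇔_; mk⇔; Equivalence)

module _ {n : ℕ} (G : Graph n) where

  OPNNonempty : Subset n → Fin n → Set
  OPNNonempty S s = ∃ λ v → Adj G v s × (∀ u → u ∈ S → Adj G v u → u ≡ s)

  OPNNonempty? : ∀ S s → Dec (OPNNonempty S s)
  OPNNonempty? S s = any? λ v →
    Adj? G v s ×-dec all? λ u → (u ∈? S) →-dec (Adj? G v u →-dec (u ≟ s))

  undominated : ∀ T → ¬ IsTDS G T → ∃ λ v → ¬ (∃ λ u → u ∈ T × Adj G v u)
  undominated T notTDS =
    ¬∀⟶∃¬ n _ (λ v → any? λ u → (u ∈? T) ×-dec Adj? G v u) notTDS

  minimal⇔OPN : ∀ {S} → IsTDS G S → IsMTDS G S ⇔ (∀ s → s ∈ S → OPNNonempty S s)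
  minimal⇔OPN {S} tds = mk⇔ opn-of-minimal minimal-of-opn
    where
    -- Removing s leaves some v undominated; all of v's S-neighbours are s.
    opn-of-minimal : IsMTDS G S → ∀ s → s ∈ S → OPNNonempty S s
    opn-of-minimal (_ , minimal) s s∈S
      with undominated (S - s) (minimal (S - s) (x∈p⇒p-x⊂p s∈S))
    ... | v , undom with tds v
    ... | u , u∈S , v~u = v , subst (Adj G v) (only-s u u∈S v~u) v~u , only-s
      where
      only-s : ∀ u → u ∈ S → Adj G v u → u ≡ s
      only-s u u∈S v~u =
        decidable-stable (u ≟ s) λ u≢s → undom (u , x∈p∧x≢y⇒x∈p-y u∈S u≢s , v~u)
    -- A TDS T ⊂ S missing x ∈ S cannot dominate x's private neighbour.
    minimal-of-opn : (∀ s → s ∈ S → OPNNonempty S s) → IsMTDS G S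
    minimal-of-opn opn = tds , λ { T (T⊆S , x , x∈S , x∉T) tdsT → missed T T⊆S x∉T (opn x x∈S) tdsT }
      where
      missed : ∀ T {x} → (∀ {u} → u ∈ T → u ∈ S) → x ∉ T → OPNNonempty S x → ¬ IsTDS G T
      missed T T⊆S x∉T (v , _ , only-x) tdsT with tdsT v
      ... | u , u∈T , v~u = x∉T (subst (_∈ T) (only-x u (T⊆S u∈T) v~u) u∈T)

  Conn-start∈ : ∀ {S u v} → Conn G S u v → u ∈ S
  Conn-start∈ (here u∈S)       = u∈S
  Conn-start∈ (step u∈S _ _) = u∈S

  InH⇒∈ : ∀ {S v} → InH G S v → v ∈ S
  InH⇒∈ (_ , _ , _ , _ , _ , _ , v⇝a , _) = Conn-start∈ v⇝a

  InH-closed : ∀ {S u v} → u ∈ S → Adj G u v → InH G S v → InH G S u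
  InH-closed u∈S u~v (a , b , c , a≢b , a≢c , b≢c , v⇝a , v⇝b , v⇝c) =
    a , b , c , a≢b , a≢c , b≢c , step u∈S u~v v⇝a , step u∈S u~v v⇝b , step u∈S u~v v⇝c

  Adj⇒≢ : ∀ {u v} → Adj G u v → ¬ u ≡ v
  Adj⇒≢ u~v u≡v = irrefl G (subst (Adj G _) (≡-sym u≡v) u~v)

  -- A vertex of S outside H: its S-neighbour w has no second S-neighbour u,
  -- else s, w, u would be three vertices of one component of G[S].
  outsideH⇒OPN : ∀ {S s} → IsTDS G S → s ∈ S → ¬ InH G S s → OPNNonempty S s
  outsideH⇒OPN {S} {s} tds s∈S s∉H with tds s
  ... | w , w∈S , s~w = w , sym G s~w , only-s
    where
    only-s : ∀ u → u ∈ S → Adj G w u → u ≡ s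
    only-s u u∈S w~u = decidable-stable (u ≟ s) λ u≢s →
      s∉H (s , w , u , Adj⇒≢ s~w , (λ s≡u → u≢s (≡-sym s≡u)) , Adj⇒≢ w~u ,
           here s∈S , step s∈S s~w (here w∈S) , step s∈S s~w (step w∈S w~u (here u∈S)))

  -- A stem x of H: its leaf y has x as only neighbour in H, hence in S.
  stem⇒OPN : ∀ {S x} → StemH G S x → OPNNonempty S x
  stem⇒OPN (x∈H , y , (y∈H , z , _ , _ , unique-z) , x~y) =
    y , sym G x~y , λ u u∈S y~u →
      trans (unique-z u (InH-closed u∈S (sym G y~u) y∈H) y~u)
            (≡-sym (unique-z _ x∈H (sym G x~y)))

  EPN⇒OPN : ∀ {S s} → EPNNonempty G S s → OPNNonempty S s
  EPN⇒OPN {S} {s} (v , _ , s~v , unshared) =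
    v , sym G s~v , λ u u∈S v~u →
      decidable-stable (u ≟ s) λ u≢s → unshared u u∈S u≢s (sym G v~u)

  -- For a non-stem s of H, a private neighbour v is external: v ∈ S would
  -- make v a leaf of H (its only H-neighbour being s) and s its stem.
  nonstem-OPN⇒EPN : ∀ {S s} → InH G S s → ¬ StemH G S s → OPNNonempty S s → EPNNonempty G S s
  nonstem-OPN⇒EPN {S} {s} s∈H nonstem (v , v~s , only-s) = v , v∉S , sym G v~s , unshared
    where
    v∉S : v ∉ S
    v∉S v∈S = nonstem (s∈H , v , v-leaf , sym G v~s)
      where
      v-leaf : LeafH G S v
      v-leaf = InH-closed v∈S v~s s∈H , s , s∈H , v~s ,
               λ z z∈H v~z → only-s z (InH⇒∈ z∈H) v~z
    unshared : ∀ s' → s' ∈ S → ¬ s' ≡ s → ¬ Adj G s' v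
    unshared s' s'∈S s'≢s s'~v = s'≢s (only-s s' s'∈S (sym G s'~v))

  EPN-condition⇒OPN : ∀ {S} → IsTDS G S →
    (∀ s → InH G S s → ¬ StemH G S s → EPNNonempty G S s) →
    ∀ s → s ∈ S → OPNNonempty S s
  EPN-condition⇒OPN {S} tds condition s s∈S =
    decidable-stable (OPNNonempty? S s) λ no-OPN → ¬¬-excluded-middle λ
      { (no s∉H)  → no-OPN (outsideH⇒OPN tds s∈S s∉H)
      ; (yes s∈H) → ¬¬-excluded-middle λ
          { (yes stem)   → no-OPN (stem⇒OPN stem)
          ; (no nonstem) → no-OPN (EPN⇒OPN (condition s s∈H nonstem)) } }

corollary1p4 : (n : ℕ) (G : Graph n) → NoIsolated G → (S : Subset n) → IsTDS G S →
    IsMTDS G S ⇔ (∀ s → InH G S s → ¬ StemH G S s → EPNNonempty G S s)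
corollary1p4 n G _ S tds = mk⇔
  (λ minimal s s∈H nonstem →
     nonstem-OPN⇒EPN G s∈H nonstem (to characterisation minimal s (InH⇒∈ G s∈H)))
  (λ condition → from characterisation (EPN-condition⇒OPN G tds condition))
  where
  open Equivalence
  characterisation = minimal⇔OPN G tds
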